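{- Let $(T,\mu,\eta)$ be an ordered saturation monad on $\mathsf{C}$ with saturation $(-)^*$, let $S:\mathsf{C}\to\mathsf{C}$ be a functor lifting to $\overline{S}:\mathcal{K}l(T)\to\mathcal{K}l(T)$, and let $(\overline{S},m,e)$ be a monad on $\mathcal{K}l(T)$. Assume $\overline{S}$ is locally monotonic and that for every $\alpha:X\rightsquigarrow\overline{S}X$ in $\mathcal{K}l(T)$, $$m_X\cdot\overline{S}\big[(m_X\cdot\overline{S}\alpha)^*\cdot e_X\big]=(m_X\cdot\overline{S}\alpha)^*.$$ Then the monad $TS$ (described in the context) is an ordered saturation monad.
   Context: Kleisli category $\mathcal{K}l(T)$: morphisms $X\rightsquigarrow Y$ are morphisms $X\to TY$, composition $g\cdot f=\mu_Z\circ Tg\circ f$, identity $1_X=\eta_X$; $f^\sharp=\eta_Y\circ f$. $S$ lifts to $\overline{S}$ if $\overline{S}X=SX$ and $\overline{S}(f^\sharp)=(Sf)^\sharp$. $\overline{S}$ is locally monotonic if $f\le g$ implies $\overline{S}f\le\overline{S}g$. The monad structure on $TS$ is the one obtained by composing the adjunctions $\mathsf{C}\rightleftarrows\mathcal{K}l(T)\rightleftarrows\mathcal{K}l(\overline{S})$: its Kleisli category has $Hom(X,Y)=Hom_{\mathcal{K}l(T)}(X,SY)$, composition $g\bullet f=m_Z\cdot\overline{S}g\cdot f$, identities $e_X$, and for $f:X\to Y$ in $\mathsf{C}$ the induced Kleisli morphism is $e_Y\cdot f^\sharp$; its hom-sets are ordered by the order of $\mathcal{K}l(T)$. Ordered saturation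 monad (for a monad $M$ on $\mathsf{C}$ with Kleisli composition $\cdot$, identities $1$, and $f^\sharp$ the Kleisli morphism induced by $f$ of $\mathsf{C}$): $\mathcal{K}l(M)$ order enriched (hom-sets posets, composition monotone) and for each $\alpha:X\rightsquigarrow X$ there is $\alpha^*$ with (1) $1\le\alpha^*$; (2) $\alpha\le\alpha^*$; (3) $\alpha^*\cdot\alpha^*\le\alpha^*$; (4) $\alpha^*\le\beta$ whenever $1\le\beta$, $\alpha\le\beta$, $\beta\cdot\beta\le\beta$; (5) for $f:X\to Y$ in $\mathsf{C}$ and $\beta:Y\rightsquigarrow Y$, $f^\sharp\cdot\alpha\le\beta\cdot f^\sharp\Rightarrow f^\sharp\cdot\alpha^*\le\beta^*\cdot f^\sharp$, and likewise with $\ge$. -}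

module Defs where

open import Level using (Level; _⊔_) renaming (suc to lsuc)
open import Relation.Binary.PropositionalEquality using (_≡_; refl; sym; trans; cong; cong₂; module ≡-Reasoning)
open import Relation.Binary.Structures using (IsPartialOrder)

record Category (o h : Level) : Set (lsuc (o ⊔ h)) where
  infixr 9 _∘_
  field
    Obj : Set o
    Hom : Obj → Obj → Set h
    id  : ∀ {X} → Hom X X
    _∘_ : ∀ {X Y Z} → Hom Y Z → Hom X Y → Hom X Z
    identityˡ : ∀ {X Y} {f : Hom X Y} → id ∘ f ≡ f
    identityʳ : ∀ {X Y} {f : Hom X Y} → f ∘ id ≡ f
    assoc : ∀ {W X Y Z} {f : Hom W X} {g : Hom X Y} {k : Hom Y Z} →
            (k ∘ g) ∘ f ≡ k ∘ (g ∘ f)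

record Functor {o h : Level} (C D : Category o h) : Set (o ⊔ h) where
  private
    module C = Category C
    module D = Category D
  field
    F₀ : C.Obj → D.Obj
    F₁ : ∀ {X Y} → C.Hom X Y → D.Hom (F₀ X) (F₀ Y)
    F-id : ∀ {X} → F₁ (C.id {X}) ≡ D.id
    F-∘  : ∀ {X Y Z} {f : C.Hom X Y} {g : C.Hom Y Z} →
           F₁ (g C.∘ f) ≡ F₁ g D.∘ F₁ f

record MonadOn {o h : Level} (C : Category o h) (F : Functor C C) : Set (o ⊔ h) where
  open Category C
  open Functor F
  field
    η : ∀ X → Hom X (F₀ X)
    μ : ∀ X → Hom (F₀ (F₀ X)) (F₀ X)
    η-nat : ∀ {X Y} (f : Hom X Y) → F₁ f ∘ η X ≡ η Y ∘ f
    μ-nat : ∀ {X Y} (f : Hom X Y) → F₁ f ∘ μ X ≡ μ Y ∘ F₁ (F₁ f)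
    μ-assoc : ∀ X → μ X ∘ F₁ (μ X) ≡ μ X ∘ μ (F₀ X)
    μ-unitˡ : ∀ X → μ X ∘ F₁ (η X) ≡ id
    μ-unitʳ : ∀ X → μ X ∘ η (F₀ X) ≡ id

module KleisliOf {o h : Level} {C : Category o h} {T : Functor C C}
                 (M : MonadOn C T) where
  open Category C
  open Functor T
  open MonadOn M
  open ≡-Reasoning

  KHom : Obj → Obj → Set h
  KHom X Y = Hom X (F₀ Y)

  _·_ : ∀ {X Y Z} → KHom Y Z → KHom X Y → KHom X Z
  _·_ {Z = Z} g f = μ Z ∘ (F₁ g ∘ f)

  _♯ : ∀ {X Y} → Hom X Y → KHom X Y
  _♯ {Y = Y} f = η Y ∘ f

  private
    ∘-cong : ∀ {X Y Z} {a a' : Hom Y Z} {b b' : Hom X Y} → a ≡ a' → b ≡ b' → a ∘ b ≡ a' ∘ b'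
    ∘-cong = cong₂ _∘_

    idL : ∀ {X Y} (f : KHom X Y) → η Y · f ≡ f
    idL {Y = Y} f = begin
      μ Y ∘ (F₁ (η Y) ∘ f) ≡⟨ sym assoc ⟩
      (μ Y ∘ F₁ (η Y)) ∘ f ≡⟨ cong (_∘ f) (μ-unitˡ Y) ⟩
      id ∘ f               ≡⟨ identityˡ ⟩
      f ∎

    idR : ∀ {X Y} (f : KHom X Y) → f · η X ≡ f
    idR {X} {Y} f = begin
      μ Y ∘ (F₁ f ∘ η X)      ≡⟨ cong (μ Y ∘_) (η-nat f) ⟩
      μ Y ∘ (η (F₀ Y) ∘ f)    ≡⟨ sym assoc ⟩
      (μ Y ∘ η (F₀ Y)) ∘ f    ≡⟨ cong (_∘ f) (μ-unitʳ Y) ⟩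
      id ∘ f                  ≡⟨ identityˡ ⟩
      f ∎

    ass : ∀ {W X Y Z} (f : KHom W X) (g : KHom X Y) (k : KHom Y Z) →
          (k · g) · f ≡ k · (g · f)
    ass {W} {X} {Y} {Z} f g k = begin
      μ Z ∘ (F₁ (μ Z ∘ (F₁ k ∘ g)) ∘ f)
        ≡⟨ cong (λ u → μ Z ∘ (u ∘ f)) (trans F-∘ (cong (F₁ (μ Z) ∘_) F-∘)) ⟩
      μ Z ∘ ((F₁ (μ Z) ∘ (F₁ (F₁ k) ∘ F₁ g)) ∘ f)
        ≡⟨ cong (μ Z ∘_) assoc ⟩
      μ Z ∘ (F₁ (μ Z) ∘ ((F₁ (F₁ k) ∘ F₁ g) ∘ f))
        ≡⟨ sym assoc ⟩
      (μ Z ∘ F₁ (μ Z)) ∘ ((F₁ (F₁ k) ∘ F₁ g) ∘ f)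
        ≡⟨ cong (_∘ ((F₁ (F₁ k) ∘ F₁ g) ∘ f)) (μ-assoc Z) ⟩
      (μ Z ∘ μ (F₀ Z)) ∘ ((F₁ (F₁ k) ∘ F₁ g) ∘ f)
        ≡⟨ assoc ⟩
      μ Z ∘ (μ (F₀ Z) ∘ ((F₁ (F₁ k) ∘ F₁ g) ∘ f))
        ≡⟨ cong (μ Z ∘_) (cong (μ (F₀ Z) ∘_) assoc) ⟩
      μ Z ∘ (μ (F₀ Z) ∘ (F₁ (F₁ k) ∘ (F₁ g ∘ f)))
        ≡⟨ cong (μ Z ∘_) (sym assoc) ⟩
      μ Z ∘ ((μ (F₀ Z) ∘ F₁ (F₁ k)) ∘ (F₁ g ∘ f))
        ≡⟨ cong (λ u → μ Z ∘ (u ∘ (F₁ g ∘ f))) (sym (μ-nat k)) ⟩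
      μ Z ∘ ((F₁ k ∘ μ Y) ∘ (F₁ g ∘ f))
        ≡⟨ cong (μ Z ∘_) assoc ⟩
      μ Z ∘ (F₁ k ∘ (μ Y ∘ (F₁ g ∘ f))) ∎

  Kl : Category o h
  Kl = record
    { Obj = Obj ; Hom = KHom ; id = λ {X} → η X ; _∘_ = _·_
    ; identityˡ = λ {_} {_} {f} → idL f
    ; identityʳ = λ {_} {_} {f} → idR f
    ; assoc = λ {_} {_} {_} {_} {f} {g} {k} → ass f g k }

record KleisliData {o h : Level} (C : Category o h) (k : Level) : Set (o ⊔ h ⊔ lsuc k) where
  open Category C
  field
    KHom : Obj → Obj → Set k
    _·_  : ∀ {X Y Z} → KHom Y Z → KHom X Y → KHom X Z
    1K   : ∀ X → KHom X X
    _♯   : ∀ {X Y} → Hom X Y → KHom X Y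

record OrderedSaturation {o h k ℓ : Level} {C : Category o h}
    (K : KleisliData C k)
    (_≤_ : ∀ {X Y} → KleisliData.KHom K X Y → KleisliData.KHom K X Y → Set ℓ)
    : Set (o ⊔ h ⊔ k ⊔ ℓ) where
  open Category C using (Obj; Hom)
  open KleisliData K
  field
    isPartialOrder : ∀ {X Y} → IsPartialOrder (_≡_ {A = KHom X Y}) _≤_
    ·-mono : ∀ {X Y Z} {f f' : KHom X Y} {g g' : KHom Y Z} →
             f ≤ f' → g ≤ g' → (g · f) ≤ (g' · f')
    _* : ∀ {X} → KHom X X → KHom X X
    sat-1 : ∀ {X} (α : KHom X X) → 1K X ≤ (α *)
    sat-2 : ∀ {X} (α : KHom X X) → α ≤ (α *)
    sat-3 : ∀ {X} (α : KHom X X) → ((α *) · (α *)) ≤ (α *)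
    sat-4 : ∀ {X} (α β : KHom X X) →
            1K X ≤ β → α ≤ β → (β · β) ≤ β → (α *) ≤ β
    sat-5≤ : ∀ {X Y} (f : Hom X Y) (α : KHom X X) (β : KHom Y Y) →
             ((f ♯) · α) ≤ (β · (f ♯)) → ((f ♯) · (α *)) ≤ ((β *) · (f ♯))
    sat-5≥ : ∀ {X Y} (f : Hom X Y) (α : KHom X X) (β : KHom Y Y) →
             (β · (f ♯)) ≤ ((f ♯) · α) → ((β *) · (f ♯)) ≤ ((f ♯) · (α *))

kleisliData : ∀ {o h} {C : Category o h} {T : Functor C C} → MonadOn C T → KleisliData C h
kleisliData M = record
  { KHom = KHom ; _·_ = _·_ ; 1K = MonadOn.η M ; _♯ = _♯ }
  where open KleisliOf M

record Lifting {o h : Level} {C : Category o h} {T : Functor C C}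
               (M : MonadOn C T) (S : Functor C C) : Set (o ⊔ h) where
  open Category C
  open KleisliOf M
  private module S = Functor S
  field
    F₁ : ∀ {X Y} → KHom X Y → KHom (S.F₀ X) (S.F₀ Y)
    F-id : ∀ {X} → F₁ (MonadOn.η M X) ≡ MonadOn.η M (S.F₀ X)
    F-∘  : ∀ {X Y Z} {f : KHom X Y} {g : KHom Y Z} → F₁ (g · f) ≡ F₁ g · F₁ f
    lifts : ∀ {X Y} (f : Hom X Y) → F₁ (f ♯) ≡ (S.F₁ f) ♯

liftedFunctor : ∀ {o h} {C : Category o h} {T : Functor C C} {M : MonadOn C T}
                {S : Functor C C} → Lifting M S → Functor (KleisliOf.Kl M) (KleisliOf.Kl M)
liftedFunctor {S = S} L = record
  { F₀ = Functor.F₀ S ; F₁ = Lifting.F₁ L ; F-id = Lifting.F-id L ; F-∘ = Lifting.F-∘ L }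

TSKleisli : ∀ {o h} {C : Category o h} {T : Functor C C} {M : MonadOn C T}
            {S : Functor C C} (L : Lifting M S) →
            MonadOn (KleisliOf.Kl M) (liftedFunctor L) → KleisliData C h
TSKleisli {M = M} {S = S} L N = record
  { KHom = λ X Y → KHom X (Functor.F₀ S Y)
  ; _·_ = λ {X} {Y} {Z} g f → m Z · (Lifting.F₁ L g · f)
  ; 1K = e
  ; _♯ = λ {X} {Y} f → e Y · (f ♯) }
  where
    open KleisliOf M
    m = MonadOn.μ N
    e = MonadOn.η N

-- Every TS-morphism β : X ⇝ SY is recovered from its Kleisli extension
-- β♭ = m_Y · S̄β : SX ⇝ SY as β = β♭ · e_X, and (-)♭ is a functor from the
-- Kleisli category of TS into Kl(T) sending the TS-morphism induced by f to
-- (Sf)♯. Local monotonicity of S̄ makes (-)♭ an order embedding, and the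
-- hypothesis says exactly that (α♭)* · e_X is the TS-morphism whose extension
-- is α♭*. Hence each saturation axiom for TS is the image under (-)♭ of the
-- corresponding axiom for T.
module Submission where

open import Defs
open import Level using (Level)
open import Relation.Binary.PropositionalEquality using (_≡_; cong; cong₂; sym; trans; module ≡-Reasoning)
open import Relation.Binary.Bundles using (Poset)
import Relation.Binary.Reasoning.PartialOrder as PosetReasoning

module KleisliExtension {o h : Level} {C : Category o h} {T : Functor C C} {M : MonadOn C T}
    {S : Functor C C} (L : Lifting M S) (N : MonadOn (KleisliOf.Kl M) (liftedFunctor L)) where

  open Category C using (Hom)
  open KleisliOf M using (KHom; _·_; _♯; Kl)
  open Functor S using (F₀; F₁)
  open MonadOn N using (η-nat; μ-nat; μ-assoc; μ-unitˡ; μ-unitʳ) renaming (μ to m; η to e)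
  open Category Kl using (assoc; identityˡ)
  open ≡-Reasoning

  S̄ : ∀ {X Y} → KHom X Y → KHom (F₀ X) (F₀ Y)
  S̄ = Lifting.F₁ L

  infixr 9 _•_
  infix 25 _♭ _♯ˢ
  _•_ : ∀ {X Y Z} → KHom Y (F₀ Z) → KHom X (F₀ Y) → KHom X (F₀ Z)
  _•_ {Z = Z} g f = m Z · (S̄ g · f)

  _♯ˢ : ∀ {X Y} → Hom X Y → KHom X (F₀ Y)
  _♯ˢ {Y = Y} f = e Y · (f ♯)

  _♭ : ∀ {X Y} → KHom X (F₀ Y) → KHom (F₀ X) (F₀ Y)
  _♭ {Y = Y} β = m Y · S̄ β

  •-♭ : ∀ {X Y Z} (g : KHom Y (F₀ Z)) (f : KHom X (F₀ Y)) → g • f ≡ (g ♭) · f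
  •-♭ g f = sym assoc

  ♭-· : ∀ {X Y Z} (β : KHom Y (F₀ Z)) (h : KHom X Y) → (β · h) ♭ ≡ (β ♭) · S̄ h
  ♭-· {Z = Z} β h = begin
    m Z · S̄ (β · h)       ≡⟨ cong (m Z ·_) (Lifting.F-∘ L) ⟩
    m Z · (S̄ β · S̄ h)     ≡⟨ assoc ⟨
    (m Z · S̄ β) · S̄ h     ∎

  ♭-unit : ∀ X → e X ♭ ≡ MonadOn.η M (F₀ X)
  ♭-unit = μ-unitˡ

  ♭-·-unit : ∀ {X Y} (β : KHom X (F₀ Y)) → (β ♭) · e X ≡ β
  ♭-·-unit {X} {Y} β = begin
    (m Y · S̄ β) · e X        ≡⟨ assoc ⟩
    m Y · (S̄ β · e X)        ≡⟨ cong (m Y ·_) (η-nat β) ⟩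
    m Y · (e (F₀ Y) · β)     ≡⟨ assoc ⟨
    (m Y · e (F₀ Y)) · β     ≡⟨ cong (_· β) (μ-unitʳ Y) ⟩
    MonadOn.η M (F₀ Y) · β   ≡⟨ identityˡ ⟩
    β                        ∎

  ♭-♭ : ∀ {X Y} (β : KHom X (F₀ Y)) → (β ♭) ♭ ≡ (β ♭) · m X
  ♭-♭ {X} {Y} β = begin
    m Y · S̄ (m Y · S̄ β)          ≡⟨ cong (m Y ·_) (Lifting.F-∘ L) ⟩
    m Y · (S̄ (m Y) · S̄ (S̄ β))    ≡⟨ assoc ⟨
    (m Y · S̄ (m Y)) · S̄ (S̄ β)    ≡⟨ cong (_· S̄ (S̄ β)) (μ-assoc Y) ⟩
    (m Y · m (F₀ Y)) · S̄ (S̄ β)   ≡⟨ assoc ⟩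
    m Y · (m (F₀ Y) · S̄ (S̄ β))   ≡⟨ cong (m Y ·_) (μ-nat β) ⟨
    m Y · (S̄ β · m X)            ≡⟨ assoc ⟨
    (m Y · S̄ β) · m X            ∎

  ♭-• : ∀ {X Y Z} (g : KHom Y (F₀ Z)) (f : KHom X (F₀ Y)) → (g • f) ♭ ≡ (g ♭) · (f ♭)
  ♭-• {X} {Y} g f = begin
    (g • f) ♭              ≡⟨ cong _♭ (•-♭ g f) ⟩
    ((g ♭) · f) ♭          ≡⟨ ♭-· (g ♭) f ⟩
    ((g ♭) ♭) · S̄ f        ≡⟨ cong (_· S̄ f) (♭-♭ g) ⟩
    ((g ♭) · m Y) · S̄ f    ≡⟨ assoc ⟩
    (g ♭) · (f ♭)          ∎

  ♭-♯ˢ : ∀ {X Y} (f : Hom X Y) → (f ♯ˢ) ♭ ≡ (F₁ f) ♯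
  ♭-♯ˢ {Y = Y} f = begin
    (e Y · (f ♯)) ♭                 ≡⟨ ♭-· (e Y) (f ♯) ⟩
    (e Y ♭) · S̄ (f ♯)               ≡⟨ cong (_· S̄ (f ♯)) (♭-unit Y) ⟩
    MonadOn.η M (F₀ Y) · S̄ (f ♯)    ≡⟨ identityˡ ⟩
    S̄ (f ♯)                         ≡⟨ Lifting.lifts L f ⟩
    (F₁ f) ♯                        ∎

  ♯ˢ-•-♭ : ∀ {X Y W} (f : Hom X Y) (γ : KHom W (F₀ X)) → ((f ♯ˢ) • γ) ♭ ≡ ((F₁ f) ♯) · (γ ♭)
  ♯ˢ-•-♭ f γ = trans (♭-• (f ♯ˢ) γ) (cong (_· (γ ♭)) (♭-♯ˢ f))

  •-♯ˢ-♭ : ∀ {X Y Z} (f : Hom X Y) (γ : KHom Y (F₀ Z)) → (γ • (f ♯ˢ)) ♭ ≡ (γ ♭) · ((F₁ f) ♯)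
  •-♯ˢ-♭ f γ = trans (♭-• γ (f ♯ˢ)) (cong ((γ ♭) ·_) (♭-♯ˢ f))

module TSSaturation {o h ℓ : Level} {C : Category o h} {T : Functor C C} {M : MonadOn C T}
    {_≤_ : ∀ {X Y} → KleisliOf.KHom M X Y → KleisliOf.KHom M X Y → Set ℓ}
    (sat : OrderedSaturation (kleisliData M) _≤_)
    {S : Functor C C} (L : Lifting M S) (N : MonadOn (KleisliOf.Kl M) (liftedFunctor L))
    (S̄-mono : ∀ {X Y} {f g : KleisliOf.KHom M X Y} → f ≤ g → Lifting.F₁ L f ≤ Lifting.F₁ L g)
    where

  open Category C using (Obj; Hom)
  open KleisliOf M using (KHom; _·_; _♯)
  open Functor S using (F₀; F₁)
  open MonadOn N using () renaming (η to e)
  open OrderedSaturation sat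
  open KleisliExtension L N

  homPoset : Obj → Obj → Poset h h ℓ
  homPoset X Y = record { Carrier = KHom X Y ; _≈_ = _≡_ ; _≤_ = _≤_ ; isPartialOrder = isPartialOrder }

  module ≤-Reasoning {X Y : Obj} = PosetReasoning (homPoset X Y)
  open ≤-Reasoning

  ≤-refl : ∀ {X Y} {f : KHom X Y} → f ≤ f
  ≤-refl {X} {Y} = Poset.refl (homPoset X Y)

  ♭-mono : ∀ {X Y} {α β : KHom X (F₀ Y)} → α ≤ β → α ♭ ≤ β ♭
  ♭-mono p = ·-mono (S̄-mono p) ≤-refl

  ♭-reflects-≤ : ∀ {X Y} {α β : KHom X (F₀ Y)} → α ♭ ≤ β ♭ → α ≤ β
  ♭-reflects-≤ {X} {α = α} {β} p = begin
    α              ≡⟨ ♭-·-unit α ⟨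
    (α ♭) · e X    ≤⟨ ·-mono ≤-refl p ⟩
    (β ♭) · e X    ≡⟨ ♭-·-unit β ⟩
    β              ∎

  •-mono : ∀ {X Y Z} {f f' : KHom X (F₀ Y)} {g g' : KHom Y (F₀ Z)} →
           f ≤ f' → g ≤ g' → (g • f) ≤ (g' • f')
  •-mono p q = ·-mono (·-mono p (S̄-mono q)) ≤-refl

  infix 25 _⁺
  _⁺ : ∀ {X} → KHom X (F₀ X) → KHom X (F₀ X)
  _⁺ {X} α = ((α ♭) *) · e X

  module _ (♭-⁺ : ∀ X (α : KHom X (F₀ X)) → (α ⁺) ♭ ≡ (α ♭) *) where

    ⁺-unit : ∀ {X} (α : KHom X (F₀ X)) → e X ≤ α ⁺
    ⁺-unit {X} α = ♭-reflects-≤ (begin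
      e X ♭                    ≡⟨ ♭-unit X ⟩
      MonadOn.η M (F₀ X)       ≤⟨ sat-1 (α ♭) ⟩
      (α ♭) *                  ≡⟨ ♭-⁺ X α ⟨
      (α ⁺) ♭                  ∎)

    ⁺-extensive : ∀ {X} (α : KHom X (F₀ X)) → α ≤ α ⁺
    ⁺-extensive {X} α = ♭-reflects-≤ (begin
      α ♭                      ≤⟨ sat-2 (α ♭) ⟩
      (α ♭) *                  ≡⟨ ♭-⁺ X α ⟨
      (α ⁺) ♭                  ∎)

    ⁺-idempotent : ∀ {X} (α : KHom X (F₀ X)) → (α ⁺ • α ⁺) ≤ α ⁺
    ⁺-idempotent {X} α = ♭-reflects-≤ (begin
      (α ⁺ • α ⁺) ♭            ≡⟨ ♭-• (α ⁺) (α ⁺) ⟩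
      ((α ⁺) ♭) · ((α ⁺) ♭)    ≡⟨ cong₂ _·_ (♭-⁺ X α) (♭-⁺ X α) ⟩
      ((α ♭) *) · ((α ♭) *)    ≤⟨ sat-3 (α ♭) ⟩
      (α ♭) *                  ≡⟨ ♭-⁺ X α ⟨
      (α ⁺) ♭                  ∎)

    ⁺-least : ∀ {X} (α β : KHom X (F₀ X)) → e X ≤ β → α ≤ β → (β • β) ≤ β → α ⁺ ≤ β
    ⁺-least {X} α β e≤β α≤β ββ≤β = ♭-reflects-≤ (begin
      (α ⁺) ♭                  ≡⟨ ♭-⁺ X α ⟩
      (α ♭) *                  ≤⟨ sat-4 (α ♭) (β ♭) unit≤β♭ (♭-mono α≤β) β♭β♭≤β♭ ⟩
      β ♭                      ∎)
      where
      unit≤β♭ : MonadOn.η M (F₀ X) ≤ β ♭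
      unit≤β♭ = begin
        MonadOn.η M (F₀ X)     ≡⟨ ♭-unit X ⟨
        e X ♭                  ≤⟨ ♭-mono e≤β ⟩
        β ♭                    ∎
      β♭β♭≤β♭ : ((β ♭) · (β ♭)) ≤ β ♭
      β♭β♭≤β♭ = begin
        (β ♭) · (β ♭)          ≡⟨ ♭-• β β ⟨
        (β • β) ♭              ≤⟨ ♭-mono ββ≤β ⟩
        β ♭                    ∎

    ⁺-preserves-≤-square : ∀ {X Y} (f : Hom X Y) (α : KHom X (F₀ X)) (β : KHom Y (F₀ Y)) →
      ((f ♯ˢ) • α) ≤ (β • (f ♯ˢ)) → ((f ♯ˢ) • α ⁺) ≤ (β ⁺ • (f ♯ˢ))
    ⁺-preserves-≤-square {X} {Y} f α β p = ♭-reflects-≤ (begin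
      ((f ♯ˢ) • α ⁺) ♭          ≡⟨ ♯ˢ-•-♭ f (α ⁺) ⟩
      ((F₁ f) ♯) · ((α ⁺) ♭)    ≡⟨ cong (((F₁ f) ♯) ·_) (♭-⁺ X α) ⟩
      ((F₁ f) ♯) · ((α ♭) *)    ≤⟨ sat-5≤ (F₁ f) (α ♭) (β ♭) square♭ ⟩
      ((β ♭) *) · ((F₁ f) ♯)    ≡⟨ cong (_· ((F₁ f) ♯)) (♭-⁺ Y β) ⟨
      ((β ⁺) ♭) · ((F₁ f) ♯)    ≡⟨ •-♯ˢ-♭ f (β ⁺) ⟨
      (β ⁺ • (f ♯ˢ)) ♭          ∎)
      where
      square♭ : (((F₁ f) ♯) · (α ♭)) ≤ ((β ♭) · ((F₁ f) ♯))
      square♭ = begin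
        ((F₁ f) ♯) · (α ♭)      ≡⟨ ♯ˢ-•-♭ f α ⟨
        ((f ♯ˢ) • α) ♭          ≤⟨ ♭-mono p ⟩
        (β • (f ♯ˢ)) ♭          ≡⟨ •-♯ˢ-♭ f β ⟩
        (β ♭) · ((F₁ f) ♯)      ∎

    ⁺-preserves-≥-square : ∀ {X Y} (f : Hom X Y) (α : KHom X (F₀ X)) (β : KHom Y (F₀ Y)) →
      (β • (f ♯ˢ)) ≤ ((f ♯ˢ) • α) → (β ⁺ • (f ♯ˢ)) ≤ ((f ♯ˢ) • α ⁺)
    ⁺-preserves-≥-square {X} {Y} f α β p = ♭-reflects-≤ (begin
      (β ⁺ • (f ♯ˢ)) ♭          ≡⟨ •-♯ˢ-♭ f (β ⁺) ⟩
      ((β ⁺) ♭) · ((F₁ f) ♯)    ≡⟨ cong (_· ((F₁ f) ♯)) (♭-⁺ Y β) ⟩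
      ((β ♭) *) · ((F₁ f) ♯)    ≤⟨ sat-5≥ (F₁ f) (α ♭) (β ♭) square♭ ⟩
      ((F₁ f) ♯) · ((α ♭) *)    ≡⟨ cong (((F₁ f) ♯) ·_) (♭-⁺ X α) ⟨
      ((F₁ f) ♯) · ((α ⁺) ♭)    ≡⟨ ♯ˢ-•-♭ f (α ⁺) ⟨
      ((f ♯ˢ) • α ⁺) ♭          ∎)
      where
      square♭ : ((β ♭) · ((F₁ f) ♯)) ≤ (((F₁ f) ♯) · (α ♭))
      square♭ = begin
        (β ♭) · ((F₁ f) ♯)      ≡⟨ •-♯ˢ-♭ f β ⟨
        (β • (f ♯ˢ)) ♭          ≤⟨ ♭-mono p ⟩
        ((f ♯ˢ) • α) ♭          ≡⟨ ♯ˢ-•-♭ f α ⟩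
        ((F₁ f) ♯) · (α ♭)      ∎

  orderedSaturation : (∀ X (α : KHom X (F₀ X)) → (α ⁺) ♭ ≡ (α ♭) *) →
                      OrderedSaturation (TSKleisli L N) _≤_
  orderedSaturation ♭-⁺ = record
    { isPartialOrder = isPartialOrder
    ; ·-mono = •-mono
    ; _* = _⁺
    ; sat-1 = ⁺-unit ♭-⁺
    ; sat-2 = ⁺-extensive ♭-⁺
    ; sat-3 = ⁺-idempotent ♭-⁺
    ; sat-4 = ⁺-least ♭-⁺
    ; sat-5≤ = ⁺-preserves-≤-square ♭-⁺
    ; sat-5≥ = ⁺-preserves-≥-square ♭-⁺ }

theorem5p8 : ∀ {o h ℓ : Level} (C : Category o h) (T : Functor C C) (M : MonadOn C T)
    (_≤_ : ∀ {X Y} → KleisliOf.KHom M X Y → KleisliOf.KHom M X Y → Set ℓ)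
    (sat : OrderedSaturation (kleisliData M) _≤_)
    (S : Functor C C) (L : Lifting M S) (N : MonadOn (KleisliOf.Kl M) (liftedFunctor L)) →
    (∀ {X Y} {f g : KleisliOf.KHom M X Y} → f ≤ g → Lifting.F₁ L f ≤ Lifting.F₁ L g) →
    (∀ X (α : KleisliOf.KHom M X (Functor.F₀ S X)) →
    KleisliOf._·_ M (MonadOn.μ N X)
    (Lifting.F₁ L (KleisliOf._·_ M
    (OrderedSaturation._* sat (KleisliOf._·_ M (MonadOn.μ N X) (Lifting.F₁ L α)))
    (MonadOn.η N X)))
    ≡ OrderedSaturation._* sat (KleisliOf._·_ M (MonadOn.μ N X) (Lifting.F₁ L α))) →
    OrderedSaturation (TSKleisli L N) _≤_
theorem5p8 C T M _≤_ sat S L N S̄-mono ♭-⁺ = TSSaturation.orderedSaturation sat L N S̄-mono ♭-⁺
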